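{- For all $j,n,k\in\mathbb{N}$, the coefficient of $q^k$ in the $q$-Stirling number of the first kind $c(n,j)(q)$ equals the number of permutations $\rho\in S_n$ with exactly $j$ cycles such that $\operatorname{coinv}_{s_\rho}=k$.
   Context: For $m\ge1$, $[m]=1+q+\cdots+q^{m-1}$, $[0]=0$. $c(n,j)(q)$ is defined by $c(0,0)(q)=1$, $c(0,j)(q)=c(n,0)(q)=0$ for $n,j\ge1$, and $c(n,j)(q)=c(n-1,j-1)(q)+[n-1]\,c(n-1,j)(q)$ for $n,j\ge1$. For $\rho\in S_n$, the word $s_\rho$ is obtained by writing each cycle of $\rho$ starting with its maximum, listing cycles in decreasing order of their maxima, and omitting brackets. For such a word $s$, $\operatorname{coinv}_s=\sum_i|\{j>i: i\text{ appears to the left of } j \text{ in } s\}|$. -}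

module Defs where

open import Data.Bool using (Bool; true; false; _∧_; if_then_else_)
open import Data.Nat using (ℕ; zero; suc; _+_; _*_; _≡ᵇ_; _<ᵇ_; _≤ᵇ_)
open import Data.Fin using (Fin; toℕ)
open import Data.List using (List; []; _∷_; [_]; map; concatMap; replicate; length; filterᵇ; reverse)
open import Data.List.Base using (allFin)
open import Data.Vec using (Vec; lookup) renaming ([] to []ᵛ; _∷_ to _∷ᵛ_)

-- Polynomials in q with ℕ coefficients, as coefficient lists
-- (constant term first).

Poly : Set
Poly = List ℕ

infixl 6 _⊕_
_⊕_ : Poly → Poly → Poly
[] ⊕ q = q
(a ∷ p) ⊕ [] = a ∷ p
(a ∷ p) ⊕ (b ∷ q) = (a + b) ∷ (p ⊕ q)

scale : ℕ → Poly → Poly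
scale a = map (a *_)

infixl 7 _⊗_
_⊗_ : Poly → Poly → Poly
[] ⊗ q = []
(a ∷ p) ⊗ q = scale a q ⊕ (0 ∷ (p ⊗ q))

coeff : Poly → ℕ → ℕ
coeff [] k = 0
coeff (a ∷ p) zero = a
coeff (a ∷ p) (suc k) = coeff p k

qint : ℕ → Poly
qint m = replicate m 1

c : ℕ → ℕ → Poly
c zero zero = [ 1 ]
c zero (suc j) = []
c (suc n) zero = []
c (suc n) (suc j) = c n j ⊕ (qint n ⊗ c n (suc j))

allᵇ : ∀ {A : Set} → (A → Bool) → List A → Bool
allᵇ p [] = true
allᵇ p (x ∷ xs) = p x ∧ allᵇ p xs

-- Permutations of {0,…,n-1} (standing for {1,…,n}), represented as
-- vectors of images ρ = (ρ 0, …, ρ (n-1)); we enumerate all maps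
-- Fin n → Fin n and keep the bijective ones.

_=ᶠ_ : ∀ {n} → Fin n → Fin n → Bool
x =ᶠ y = toℕ x ≡ᵇ toℕ y

allVecs : (n m : ℕ) → List (Vec (Fin n) m)
allVecs n zero = []ᵛ ∷ []
allVecs n (suc m) = concatMap (λ x → map (x ∷ᵛ_) (allVecs n m)) (allFin n)

-- injective (hence bijective) map Fin n → Fin n
isPerm : ∀ {n} → Vec (Fin n) n → Bool
isPerm {n} v =
  allᵇ (λ i → allᵇ (λ i' → (i =ᶠ i') Data.Bool.∨ Data.Bool.not (lookup v i =ᶠ lookup v i'))
                 (allFin n))
      (allFin n)

orbitFrom : ∀ {n} → Vec (Fin n) n → Fin n → Fin n → ℕ → List (Fin n)
orbitFrom ρ start x zero = []
orbitFrom ρ start x (suc fuel) =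
  if x =ᶠ start then [] else x ∷ orbitFrom ρ start (lookup ρ x) fuel

cycleOf : ∀ {n} → Vec (Fin n) n → Fin n → List (Fin n)
cycleOf {n} ρ i = i ∷ orbitFrom ρ i (lookup ρ i) n

isCycleMax : ∀ {n} → Vec (Fin n) n → Fin n → Bool
isCycleMax ρ i = allᵇ (λ x → toℕ x ≤ᵇ toℕ i) (cycleOf ρ i)

cycleMaxima : ∀ {n} → Vec (Fin n) n → List (Fin n)
cycleMaxima {n} ρ = filterᵇ (isCycleMax ρ) (reverse (allFin n))

numCycles : ∀ {n} → Vec (Fin n) n → ℕ
numCycles ρ = length (cycleMaxima ρ)

sWord : ∀ {n} → Vec (Fin n) n → List (Fin n)
sWord ρ = concatMap (cycleOf ρ) (cycleMaxima ρ)

coinv : ∀ {n} → List (Fin n) → ℕ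
coinv [] = 0
coinv (x ∷ xs) = length (filterᵇ (λ y → toℕ x <ᵇ toℕ y) xs) + coinv xs

countPerms : ℕ → ℕ → ℕ → ℕ
countPerms n j k =
  length (filterᵇ (λ ρ → isPerm ρ ∧ (numCycles ρ ≡ᵇ j) ∧ (coinv (sWord ρ) ≡ᵇ k))
                  (allVecs n n))

-- Every permutation of {0, …, n} arises exactly once from a permutation of {1, …, n}
-- by inserting the least letter 0, either as a new fixed point or right after some x
-- in the cycle of x.  In the first case 0 is appended to s_ρ, which adds a cycle and
-- no coinversion; in the second case 0 lands right after x in s_ρ, which keeps the
-- number of cycles and adds one coinversion for each letter to the right of x.  As
-- s_ρ lists every letter once, these numbers are 0, 1, …, n − 1, so the generating
-- polynomials Σ_ρ q^coinv satisfy c(n+1, j) = c(n, j−1) + [n] c(n, j), the recurrence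
-- of the q-Stirling numbers, and agree with them for n = 0.

module Submission where

open import Defs
open import Data.Bool using (Bool; true; false; T; _∧_; _∨_; not; if_then_else_)
open import Data.Bool.Properties using (T-∧; ∧-zeroʳ)
open import Data.Fin as Fin using (Fin; toℕ; punchOut) renaming (zero to fzero; suc to fsuc)
open import Data.Fin.Properties using (toℕ<n; toℕ-injective; suc-injective; pigeonhole; punchOut-injective; punchIn-punchOut; <⇒notInjective; any?)
open import Data.List.Membership.Propositional.Properties using (∈-allFin; ∈-filter⁺; ∈-filter⁻; ∈-map⁺; ∈-map⁻; ∈-cartesianProductWith⁺; ∈-cartesianProductWith⁻)
open import Data.List.Membership.Propositional.Properties.WithK using (unique∧set⇒bag)
open import Data.List.Relation.Binary.BagAndSetEquality using (∼bag⇒↭)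
open import Data.List using (List; []; _∷_; [_]; _++_; map; length; concatMap; filterᵇ; reverse; allFin; upTo; downFrom; cartesianProductWith)
open import Data.List.Properties using (filter-++; filter-≐; unfold-reverse; map-tabulate; reverse-map; length-++; length-map; map-++; concatMap-++; ++-identityʳ; map-cong-local; map-∘; map-applyUpTo; reverse-upTo; length-tabulate)
open import Data.List.Membership.Propositional using (_∈_; _∉_)
open import Data.List.Relation.Unary.Any using (here; there)
open import Data.List.Relation.Unary.All.Properties using (All¬⇒¬Any)
open import Data.List.Relation.Unary.Unique.Propositional using (Unique; []; _∷_)
open import Data.List.Relation.Unary.Unique.Propositional.Properties using (allFin⁺; filter⁺; map⁺; cartesianProductWith⁺)
open import Data.List.Relation.Binary.Permutation.Propositional using (_↭_; ↭-refl; ↭-prep; ↭-swap; ↭-trans; ↭-sym; ↭⇒↭ₛ)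
open import Data.List.Relation.Binary.Permutation.Propositional.Properties using (++-comm; ∈-resp-↭; ↭-reverse; ↭-length) renaming (map⁺ to ↭-map⁺)
import Data.List.Relation.Binary.Permutation.Setoid.Properties as PermutationSetoidProperties
open import Data.List.Relation.Unary.All as All using (All; []; _∷_)
open import Data.Nat using (ℕ; zero; suc; _+_; _≤_; _<_; _≡ᵇ_; _<ᵇ_; _≤ᵇ_; s≤s)
open import Data.Nat.GeneralisedArithmetic using (iterate)
open import Data.Nat.Properties using (≡ᵇ⇒≡; ≡⇒≡ᵇ; n<1+n; m≤n⇒∃[o]m+o≡n; +-comm; ≤-trans; m≤n+m; ≤-pred; <⇒≤; n≤1+n; +-assoc; +-identityʳ; +-suc)
open import Data.Nat.ListAction using (sum)
open import Data.Nat.ListAction.Properties using (sum-++; sum-↭)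
open import Data.Nat.Solver using (module +-*-Solver)
open +-*-Solver using (solve; _:+_; _:=_)
open import Data.Product using (∃; ∃₂; _×_; _,_; proj₂; map₁)
open import Data.Unit using (tt)
open import Data.Vec using (Vec; lookup; tabulate) renaming ([] to []ᵛ; _∷_ to _∷ᵛ_)
open import Data.Vec.Properties using (lookup∘tabulate; ∷-injective)
open import Data.Vec.Relation.Binary.Pointwise.Extensional using (ext; Pointwise-≡⇒≡)
open import Data.Maybe using (Maybe; just; nothing)
open import Data.Maybe.Properties using (just-injective)
open import Function using (id; _∘_; _⇔_; mk⇔; Equivalence; case_of_)
open import Function.Definitions using (Injective)
open import Relation.Binary.PropositionalEquality using (_≡_; _≢_; refl; sym; trans; setoid; cong; cong₂; subst; module ≡-Reasoning; _≗_)
open import Relation.Nullary using (contradiction; yes; no)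
open import Relation.Nullary.Decidable using (T?)
open import Relation.Nullary.Reflects using (Reflects; ofʸ; ofⁿ; fromEquivalence)

Endo : ℕ → Set
Endo n = Vec (Fin n) n

lookup-ext : ∀ {A : Set} {n} {v w : Vec A n} → lookup v ≗ lookup w → v ≡ w
lookup-ext = Pointwise-≡⇒≡ ∘ ext

allFin-suc : ∀ n → allFin (suc n) ≡ fzero ∷ map fsuc (allFin n)
allFin-suc n = cong (fzero ∷_) (sym (map-tabulate id fsuc))

=ᶠ-reflects : ∀ {n} (x y : Fin n) → Reflects (x ≡ y) (x =ᶠ y)
=ᶠ-reflects x y = fromEquivalence (toℕ-injective ∘ ≡ᵇ⇒≡ (toℕ x) (toℕ y)) (≡⇒≡ᵇ (toℕ x) (toℕ y) ∘ cong toℕ)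

=ᶠ-refl : ∀ {n} (x : Fin n) → (x =ᶠ x) ≡ true
=ᶠ-refl x with x =ᶠ x | =ᶠ-reflects x x
... | true  | _      = refl
... | false | ofⁿ x≢x = contradiction refl x≢x

=ᶠ-≢ : ∀ {n} {x y : Fin n} → x ≢ y → (x =ᶠ y) ≡ false
=ᶠ-≢ {x = x} {y} x≢y with x =ᶠ y | =ᶠ-reflects x y
... | true  | ofʸ x≡y = contradiction x≡y x≢y
... | false | _       = refl

allᵇ⁻ : ∀ {A : Set} (p : A → Bool) xs → T (allᵇ p xs) → All (T ∘ p) xs
allᵇ⁻ p []       _ = []
allᵇ⁻ p (x ∷ xs) t with px , pxs ← Equivalence.to T-∧ t = px ∷ allᵇ⁻ p xs pxs

allᵇ⁺ : ∀ {A : Set} (p : A → Bool) {xs} → All (T ∘ p) xs → T (allᵇ p xs)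
allᵇ⁺ p []         = tt
allᵇ⁺ p (px ∷ pxs) = Equivalence.from T-∧ (px , allᵇ⁺ p pxs)

T-injectiveAt : ∀ {n} (v : Endo n) i j →
  T ((i =ᶠ j) ∨ not (lookup v i =ᶠ lookup v j)) ⇔ (lookup v i ≡ lookup v j → i ≡ j)
T-injectiveAt v i j with i =ᶠ j | =ᶠ-reflects i j
... | true  | ofʸ i≡j = mk⇔ (λ _ _ → i≡j) (λ _ → tt)
... | false | ofⁿ i≢j with lookup v i =ᶠ lookup v j | =ᶠ-reflects (lookup v i) (lookup v j)
...   | true  | ofʸ vi≡vj = mk⇔ (λ ()) (λ inj → i≢j (inj vi≡vj))
...   | false | ofⁿ vi≢vj = mk⇔ (λ _ vi≡vj → contradiction vi≡vj vi≢vj) (λ _ → tt)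

isPerm⇔injective : ∀ {n} (v : Endo n) → T (isPerm v) ⇔ Injective _≡_ _≡_ (lookup v)
isPerm⇔injective {n} v = mk⇔ to from
  where
  injectiveAt : Fin n → Fin n → Bool
  injectiveAt i j = (i =ᶠ j) ∨ not (lookup v i =ᶠ lookup v j)
  injectiveFrom : Fin n → Bool
  injectiveFrom i = allᵇ (injectiveAt i) (allFin n)
  to : T (isPerm v) → Injective _≡_ _≡_ (lookup v)
  to t {i} {j} = Equivalence.to (T-injectiveAt v i j)
    (All.lookup (allᵇ⁻ (injectiveAt i) _ (All.lookup (allᵇ⁻ injectiveFrom _ t) (∈-allFin i))) (∈-allFin j))
  from : Injective _≡_ _≡_ (lookup v) → T (isPerm v)
  from inj = allᵇ⁺ injectiveFrom {allFin n} (All.tabulate λ {i} _ →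
    allᵇ⁺ (injectiveAt i) {allFin n} (All.tabulate λ {j} _ → Equivalence.from (T-injectiveAt v i j) inj))

data Reaches {n} (ρ : Endo n) (s : Fin n) : Fin n → ℕ → Set where
  reached : ∀ {f} → Reaches ρ s s f
  step    : ∀ {y f} → Reaches ρ s (lookup ρ y) f → Reaches ρ s y (suc f)

Reaches-mono : ∀ {n} {ρ : Endo n} {s y f F} → f ≤ F → Reaches ρ s y f → Reaches ρ s y F
Reaches-mono _         reached  = reached
Reaches-mono (s≤s f≤F) (step r) = step (Reaches-mono f≤F r)

iterate⇒Reaches : ∀ {n} (ρ : Endo n) {s} y m → iterate (lookup ρ) y m ≡ s → Reaches ρ s y m
iterate⇒Reaches ρ y zero    refl = reached
iterate⇒Reaches ρ y (suc m) eq   = step (iterate⇒Reaches ρ (lookup ρ y) m eq)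

iterate-+ : ∀ {A : Set} (f : A → A) x a b → iterate f x (a + b) ≡ iterate f (iterate f x a) b
iterate-+ f x zero    b = refl
iterate-+ f x (suc a) b = iterate-+ f (f x) a b

iterate-injective : ∀ {A : Set} {f : A → A} → Injective _≡_ _≡_ f →
                    ∀ {x y} m → iterate f x m ≡ iterate f y m → x ≡ y
iterate-injective inj zero    eq = eq
iterate-injective inj (suc m) eq = inj (iterate-injective inj m eq)

-- By pigeonhole two of i, ρ i, …, ρⁿ i coincide; cancelling the earlier one gives a return to i.
injective⇒returns : ∀ {n} (ρ : Endo n) → Injective _≡_ _≡_ (lookup ρ) → ∀ i → Reaches ρ i (lookup ρ i) n
injective⇒returns {n} ρ inj i
  with a , b , a<b , ρᵃi≡ρᵇi ← pigeonhole (n<1+n n) (iterate (lookup ρ) i ∘ toℕ)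
  with d , a+1+d≡b ← m≤n⇒∃[o]m+o≡n a<b
  = Reaches-mono d≤n (iterate⇒Reaches ρ (lookup ρ i) d (sym ρ¹⁺ᵈi≡i))
  where
  ρ¹⁺ᵈi≡i : i ≡ iterate (lookup ρ) i (suc d)
  ρ¹⁺ᵈi≡i = iterate-injective inj (toℕ a) (begin
    iterate (lookup ρ) i (toℕ a)                                ≡⟨ ρᵃi≡ρᵇi ⟩
    iterate (lookup ρ) i (toℕ b)                                ≡⟨ cong (iterate (lookup ρ) i) (trans (sym a+1+d≡b) (cong suc (+-comm (toℕ a) d))) ⟩
    iterate (lookup ρ) i (suc d + toℕ a)                        ≡⟨ iterate-+ (lookup ρ) i (suc d) (toℕ a) ⟩
    iterate (lookup ρ) (iterate (lookup ρ) i (suc d)) (toℕ a)   ∎)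
    where open ≡-Reasoning
  d≤n : d ≤ n
  d≤n = ≤-trans (m≤n+m d (toℕ a)) (<⇒≤ (≤-pred (subst (_< suc n) (sym a+1+d≡b) (toℕ<n b))))

orbitFrom-start : ∀ {n} (ρ : Endo n) s F → orbitFrom ρ s s F ≡ []
orbitFrom-start ρ s zero    = refl
orbitFrom-start ρ s (suc F) rewrite =ᶠ-refl s = refl

orbitFrom-fuel : ∀ {n} {ρ : Endo n} {s y f} → Reaches ρ s y f → ∀ {F} → f ≤ F →
                 orbitFrom ρ s y F ≡ orbitFrom ρ s y f
orbitFrom-fuel {ρ = ρ} {s} {f = f} reached {F} _ = trans (orbitFrom-start ρ s F) (sym (orbitFrom-start ρ s f))
orbitFrom-fuel {s = s} {y} (step r) (s≤s f≤F) with y =ᶠ s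
... | true  = refl
... | false = cong (y ∷_) (orbitFrom-fuel r f≤F)

-- Inserting a new least letter

-- Fin (suc n) is Fin n shifted up by one with a new least letter 0: `insert0 ρ nothing`
-- makes 0 a fixed point, `insert0 ρ (just x)` inserts 0 right after x in the cycle of x.
insert0ᶠ : ∀ {n} → (Fin n → Fin n) → Maybe (Fin n) → Fin (suc n) → Fin (suc n)
insert0ᶠ g nothing  fzero    = fzero
insert0ᶠ g nothing  (fsuc y) = fsuc (g y)
insert0ᶠ g (just x) fzero    = fsuc (g x)
insert0ᶠ g (just x) (fsuc y) = if y =ᶠ x then fzero else fsuc (g y)

insert0 : ∀ {n} → Endo n → Maybe (Fin n) → Endo (suc n)
insert0 ρ o = tabulate (insert0ᶠ (lookup ρ) o)

lookup-insert0 : ∀ {n} (ρ : Endo n) o i → lookup (insert0 ρ o) i ≡ insert0ᶠ (lookup ρ) o i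
lookup-insert0 ρ o = lookup∘tabulate (insert0ᶠ (lookup ρ) o)

insert0After : ∀ {n} → Fin n → List (Fin n) → List (Fin (suc n))
insert0After x []       = []
insert0After x (y ∷ ys) = fsuc y ∷ (if y =ᶠ x then fzero ∷ insert0After x ys else insert0After x ys)

orbitFrom-insert0-nothing : ∀ {n} (ρ : Endo n) s y F →
  orbitFrom (insert0 ρ nothing) (fsuc s) (fsuc y) F ≡ map fsuc (orbitFrom ρ s y F)
orbitFrom-insert0-nothing ρ s y zero = refl
orbitFrom-insert0-nothing ρ s y (suc F) with y =ᶠ s
... | true  = refl
... | false rewrite lookup-insert0 ρ nothing (fsuc y) = cong (fsuc y ∷_) (orbitFrom-insert0-nothing ρ s (lookup ρ y) F)

-- The orbit in insert0 ρ (just x) also visits 0, so it needs its own bound on the fuel.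
orbitFrom-insert0-just : ∀ {n} (ρ : Endo n) x {s y f F} →
  Reaches ρ s y f → Reaches (insert0 ρ (just x)) (fsuc s) (fsuc y) F →
  orbitFrom (insert0 ρ (just x)) (fsuc s) (fsuc y) F ≡ insert0After x (orbitFrom ρ s y f)
orbitFrom-insert0-just ρ x {s} {f = f} {F} reached _ =
  trans (orbitFrom-start (insert0 ρ (just x)) (fsuc s) F) (cong (insert0After x) (sym (orbitFrom-start ρ s f)))
orbitFrom-insert0-just ρ x {s} {f = f} {F} (step _) reached =
  trans (orbitFrom-start (insert0 ρ (just x)) (fsuc s) F) (cong (insert0After x) (sym (orbitFrom-start ρ s f)))
orbitFrom-insert0-just ρ x {s} {y} (step r) (step r⁺) with y =ᶠ s
... | true  = refl
... | false rewrite lookup-insert0 ρ (just x) (fsuc y) with y =ᶠ x | =ᶠ-reflects y x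
...   | false | _ = cong (fsuc y ∷_) (orbitFrom-insert0-just ρ x r r⁺)
...   | true  | ofʸ refl with r⁺
...     | step r⁺⁺ rewrite lookup-insert0 ρ (just y) fzero =
          cong (λ w → fsuc y ∷ fzero ∷ w) (orbitFrom-insert0-just ρ y r r⁺⁺)

swap0 : ∀ {n} → Fin n → Fin (suc n) → Fin (suc n)
swap0 x fzero    = fsuc x
swap0 x (fsuc y) = if y =ᶠ x then fzero else fsuc y

swap0-involutive : ∀ {n} (x : Fin n) i → swap0 x (swap0 x i) ≡ i
swap0-involutive x fzero rewrite =ᶠ-refl x = refl
swap0-involutive x (fsuc y) with y =ᶠ x | =ᶠ-reflects y x
... | true  | ofʸ refl = refl
... | false | ofⁿ y≢x rewrite =ᶠ-≢ y≢x = refl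

insert0ᶠ-just : ∀ {n} (g : Fin n → Fin n) x i → insert0ᶠ g (just x) i ≡ insert0ᶠ g nothing (swap0 x i)
insert0ᶠ-just g x fzero    = refl
insert0ᶠ-just g x (fsuc y) with y =ᶠ x
... | true  = refl
... | false = refl

insert0ᶠ-nothing : ∀ {n} (g : Fin n → Fin n) x i → insert0ᶠ g nothing i ≡ insert0ᶠ g (just x) (swap0 x i)
insert0ᶠ-nothing g x i =
  trans (cong (insert0ᶠ g nothing) (sym (swap0-involutive x i))) (sym (insert0ᶠ-just g x (swap0 x i)))

swap0-injective : ∀ {n} (x : Fin n) → Injective _≡_ _≡_ (swap0 x)
swap0-injective x {i} {j} eq = trans (sym (swap0-involutive x i)) (trans (cong (swap0 x) eq) (swap0-involutive x j))

insert0ᶠ-nothing-injective : ∀ {n} {g : Fin n → Fin n} → Injective _≡_ _≡_ g → Injective _≡_ _≡_ (insert0ᶠ g nothing)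
insert0ᶠ-nothing-injective inj {fzero}  {fzero}  _  = refl
insert0ᶠ-nothing-injective inj {fsuc i} {fsuc j} eq = cong fsuc (inj (suc-injective eq))

insert0ᶠ-injective : ∀ {n} {g : Fin n → Fin n} → Injective _≡_ _≡_ g → ∀ o → Injective _≡_ _≡_ (insert0ᶠ g o)
insert0ᶠ-injective inj nothing = insert0ᶠ-nothing-injective inj
insert0ᶠ-injective {g = g} inj (just x) {i} {j} eq =
  swap0-injective x (insert0ᶠ-nothing-injective inj
    (trans (sym (insert0ᶠ-just g x i)) (trans eq (insert0ᶠ-just g x j))))

insert0ᶠ-just-zero : ∀ {n} (g : Fin n → Fin n) x y → insert0ᶠ g (just x) (fsuc y) ≡ fzero → y ≡ x
insert0ᶠ-just-zero g x y eq with y =ᶠ x | =ᶠ-reflects y x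
... | true  | ofʸ y≡x = y≡x
... | false | _       with () ← eq

insert0ᶠ-nothing-cancel : ∀ {n} {g g' : Fin n → Fin n} → insert0ᶠ g nothing ≗ insert0ᶠ g' nothing → g ≗ g'
insert0ᶠ-nothing-cancel eq y = suc-injective (eq (fsuc y))

insert0ᶠ-cancel : ∀ {n} {g g' : Fin n → Fin n} {o o'} → insert0ᶠ g o ≗ insert0ᶠ g' o' → g ≗ g' × o ≡ o'
insert0ᶠ-cancel {o = nothing} {nothing} eq = insert0ᶠ-nothing-cancel eq , refl
insert0ᶠ-cancel {o = nothing} {just _}  eq with () ← eq fzero
insert0ᶠ-cancel {o = just _}  {nothing} eq with () ← eq fzero
insert0ᶠ-cancel {g = g} {g'} {just x} {just x'} eq
  with refl ← insert0ᶠ-just-zero g' x' x (trans (sym (eq (fsuc x))) (sym (insert0ᶠ-nothing g x fzero)))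
  = insert0ᶠ-nothing-cancel (λ i →
      trans (insert0ᶠ-nothing g x i) (trans (eq (swap0 x i)) (sym (insert0ᶠ-nothing g' x i)))) , refl

insert0-injective : ∀ {n} {ρ ρ' : Endo n} {o o'} → insert0 ρ o ≡ insert0 ρ' o' → ρ ≡ ρ' × o ≡ o'
insert0-injective {ρ = ρ} {ρ'} {o} {o'} eq = map₁ lookup-ext (insert0ᶠ-cancel pointwise)
  where
  pointwise : insert0ᶠ (lookup ρ) o ≗ insert0ᶠ (lookup ρ') o'
  pointwise i = trans (sym (lookup-insert0 ρ o i)) (trans (cong (λ v → lookup v i) eq) (lookup-insert0 ρ' o' i))

injective⇒hits0 : ∀ {n} {h : Fin (suc n) → Fin (suc n)} → Injective _≡_ _≡_ h → ∃ λ i → h i ≡ fzero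
injective⇒hits0 {n} {h} inj with any? (λ i → h i Fin.≟ fzero)
... | yes hit = hit
... | no  miss = contradiction (λ {i} {j} → inj ∘ punchOut-injective (0≢h i) (0≢h j)) (<⇒notInjective (n<1+n n))
  where
  0≢h : ∀ i → fzero ≢ h i
  0≢h i 0≡hi = miss (i , sym 0≡hi)

-- The values of h off 0 avoid 0, so punchOut shifts them down to Fin n.
fixes0⇒insert0 : ∀ {n} (h : Fin (suc n) → Fin (suc n)) → Injective _≡_ _≡_ h → h fzero ≡ fzero →
  ∃ λ (ρ : Endo n) → Injective _≡_ _≡_ (lookup ρ) × h ≗ insert0ᶠ (lookup ρ) nothing
fixes0⇒insert0 {n} h inj h0≡0 = ρ , ρ-injective , h≗
  where
  0≢h∘suc : ∀ y → fzero ≢ h (fsuc y)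
  0≢h∘suc y 0≡h = case inj (trans (sym 0≡h) (sym h0≡0)) of λ ()
  ρ : Endo n
  ρ = tabulate λ y → punchOut (0≢h∘suc y)
  h∘suc≡ : ∀ y → h (fsuc y) ≡ fsuc (lookup ρ y)
  h∘suc≡ y = trans (sym (punchIn-punchOut (0≢h∘suc y))) (cong fsuc (sym (lookup∘tabulate _ y)))
  ρ-injective : Injective _≡_ _≡_ (lookup ρ)
  ρ-injective eq = suc-injective (inj (trans (h∘suc≡ _) (trans (cong fsuc eq) (sym (h∘suc≡ _)))))
  h≗ : h ≗ insert0ᶠ (lookup ρ) nothing
  h≗ fzero    = h0≡0
  h≗ (fsuc y) = h∘suc≡ y

-- If h (suc x) = 0 then h ∘ swap0 x fixes 0.
injective⇒insert0ᶠ : ∀ {n} (h : Fin (suc n) → Fin (suc n)) → Injective _≡_ _≡_ h →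
  ∃₂ λ (ρ : Endo n) o → Injective _≡_ _≡_ (lookup ρ) × h ≗ insert0ᶠ (lookup ρ) o
injective⇒insert0ᶠ h inj with injective⇒hits0 inj
... | fzero , h0≡0
  with ρ , ρ-injective , h≗ ← fixes0⇒insert0 h inj h0≡0 = ρ , nothing , ρ-injective , h≗
... | fsuc x , hx≡0
  with ρ , ρ-injective , h∘swap≗ ← fixes0⇒insert0 (h ∘ swap0 x) (λ eq → swap0-injective x (inj eq)) hx≡0
  = ρ , just x , ρ-injective , λ i → trans (cong h (sym (swap0-involutive x i)))
                                      (trans (h∘swap≗ (swap0 x i)) (sym (insert0ᶠ-just (lookup ρ) x i)))

injective⇒insert0 : ∀ {n} (ρ : Endo (suc n)) → Injective _≡_ _≡_ (lookup ρ) →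
  ∃₂ λ (ρ' : Endo n) o → Injective _≡_ _≡_ (lookup ρ') × ρ ≡ insert0 ρ' o
injective⇒insert0 ρ inj with ρ' , o , ρ'-injective , ρ≗ ← injective⇒insert0ᶠ (lookup ρ) inj =
  ρ' , o , ρ'-injective , lookup-ext (λ i → trans (ρ≗ i) (sym (lookup-insert0 ρ' o i)))

insert0-preserves-injective : ∀ {n} (ρ : Endo n) → Injective _≡_ _≡_ (lookup ρ) → ∀ o → Injective _≡_ _≡_ (lookup (insert0 ρ o))
insert0-preserves-injective ρ inj o {i} {j} eq =
  insert0ᶠ-injective inj o (trans (sym (lookup-insert0 ρ o i)) (trans eq (lookup-insert0 ρ o j)))

-- Cycles and the word s_ρ

insert0ʷ : ∀ {n} → Maybe (Fin n) → List (Fin n) → List (Fin (suc n))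
insert0ʷ nothing  = map fsuc
insert0ʷ (just x) = insert0After x

cycleOf-insert0 : ∀ {n} (ρ : Endo n) → Injective _≡_ _≡_ (lookup ρ) → ∀ o i →
  cycleOf (insert0 ρ o) (fsuc i) ≡ insert0ʷ o (cycleOf ρ i)
cycleOf-insert0 {n} ρ inj nothing i rewrite lookup-insert0 ρ nothing (fsuc i) =
  cong (fsuc i ∷_) (trans (orbitFrom-insert0-nothing ρ i (lookup ρ i) (suc n))
                          (cong (map fsuc) (orbitFrom-fuel (injective⇒returns ρ inj i) (n≤1+n n))))
cycleOf-insert0 {n} ρ inj (just x) i
  with injective⇒returns (insert0 ρ (just x)) (insert0-preserves-injective ρ inj (just x)) (fsuc i)
... | r⁺ rewrite lookup-insert0 ρ (just x) (fsuc i) with i =ᶠ x | =ᶠ-reflects i x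
...   | false | _ = cong (fsuc i ∷_) (orbitFrom-insert0-just ρ x (injective⇒returns ρ inj i) r⁺)
...   | true  | ofʸ refl with r⁺
...     | step r⁺⁺ rewrite lookup-insert0 ρ (just i) fzero =
          cong (λ w → fsuc i ∷ fzero ∷ w) (orbitFrom-insert0-just ρ i (injective⇒returns ρ inj i) r⁺⁺)

suc≤ᵇsuc : ∀ a b → (suc a ≤ᵇ suc b) ≡ (a ≤ᵇ b)
suc≤ᵇsuc zero    b = refl
suc≤ᵇsuc (suc a) b = refl

allᵇ-cong : ∀ {A : Set} {p q : A → Bool} → p ≗ q → allᵇ p ≗ allᵇ q
allᵇ-cong p≗q []       = refl
allᵇ-cong p≗q (x ∷ xs) = cong₂ _∧_ (p≗q x) (allᵇ-cong p≗q xs)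

allᵇ-insert0ʷ : ∀ {n} (p : Fin (suc n) → Bool) → p fzero ≡ true → ∀ o w → allᵇ p (insert0ʷ o w) ≡ allᵇ (p ∘ fsuc) w
allᵇ-insert0ʷ p p0 nothing  []      = refl
allᵇ-insert0ʷ p p0 nothing  (y ∷ w) = cong (p (fsuc y) ∧_) (allᵇ-insert0ʷ p p0 nothing w)
allᵇ-insert0ʷ p p0 (just x) []      = refl
allᵇ-insert0ʷ p p0 (just x) (y ∷ w) with y =ᶠ x
... | true  rewrite p0 = cong (p (fsuc y) ∧_) (allᵇ-insert0ʷ p p0 (just x) w)
... | false            = cong (p (fsuc y) ∧_) (allᵇ-insert0ʷ p p0 (just x) w)

isCycleMax-insert0 : ∀ {n} (ρ : Endo n) → Injective _≡_ _≡_ (lookup ρ) → ∀ o i →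
  isCycleMax (insert0 ρ o) (fsuc i) ≡ isCycleMax ρ i
isCycleMax-insert0 ρ inj o i = begin
  allᵇ (λ z → toℕ z ≤ᵇ suc (toℕ i)) (cycleOf (insert0 ρ o) (fsuc i))
    ≡⟨ cong (allᵇ _) (cycleOf-insert0 ρ inj o i) ⟩
  allᵇ (λ z → toℕ z ≤ᵇ suc (toℕ i)) (insert0ʷ o (cycleOf ρ i))
    ≡⟨ allᵇ-insert0ʷ _ refl o (cycleOf ρ i) ⟩
  allᵇ (λ z → suc (toℕ z) ≤ᵇ suc (toℕ i)) (cycleOf ρ i)
    ≡⟨ allᵇ-cong (λ z → suc≤ᵇsuc (toℕ z) (toℕ i)) (cycleOf ρ i) ⟩
  allᵇ (λ z → toℕ z ≤ᵇ toℕ i) (cycleOf ρ i)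
    ∎
  where open ≡-Reasoning

newCycle : ∀ {n} → Maybe (Fin n) → List (Fin (suc n))
newCycle nothing  = [ fzero ]
newCycle (just _) = []

cycleMaxima0-insert0 : ∀ {n} (ρ : Endo n) o → filterᵇ (isCycleMax (insert0 ρ o)) [ fzero ] ≡ newCycle o
cycleMaxima0-insert0 ρ o rewrite lookup-insert0 ρ o fzero with o
... | nothing = refl
... | just _  = refl

cycleOf0-insert0 : ∀ {n} (ρ : Endo n) o → concatMap (cycleOf (insert0 ρ o)) (newCycle o) ≡ newCycle o
cycleOf0-insert0 ρ nothing rewrite lookup-insert0 ρ nothing fzero = refl
cycleOf0-insert0 ρ (just _) = refl

reverse-allFin-suc : ∀ n → reverse (allFin (suc n)) ≡ map fsuc (reverse (allFin n)) ++ [ fzero ]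
reverse-allFin-suc n = begin
  reverse (allFin (suc n))                    ≡⟨ cong reverse (allFin-suc n) ⟩
  reverse (fzero ∷ map fsuc (allFin n))       ≡⟨ unfold-reverse fzero (map fsuc (allFin n)) ⟩
  reverse (map fsuc (allFin n)) ++ [ fzero ]  ≡⟨ cong (_++ [ fzero ]) (sym (reverse-map fsuc (allFin n))) ⟩
  map fsuc (reverse (allFin n)) ++ [ fzero ]  ∎
  where open ≡-Reasoning

filterᵇ-map : ∀ {A B : Set} (p : B → Bool) (f : A → B) xs → filterᵇ p (map f xs) ≡ map f (filterᵇ (p ∘ f) xs)
filterᵇ-map p f []       = refl
filterᵇ-map p f (x ∷ xs) with p (f x)
... | true  = cong (f x ∷_) (filterᵇ-map p f xs)
... | false = filterᵇ-map p f xs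

filterᵇ-cong : ∀ {A : Set} {p q : A → Bool} → p ≗ q → filterᵇ p ≗ filterᵇ q
filterᵇ-cong {p = p} {q} p≗q = filter-≐ (T? ∘ p) (T? ∘ q) ((λ {x} → subst T (p≗q x)) , (λ {x} → subst T (sym (p≗q x))))

cycleMaxima-insert0 : ∀ {n} (ρ : Endo n) → Injective _≡_ _≡_ (lookup ρ) → ∀ o →
  cycleMaxima (insert0 ρ o) ≡ map fsuc (cycleMaxima ρ) ++ newCycle o
cycleMaxima-insert0 {n} ρ inj o = begin
  filterᵇ p (reverse (allFin (suc n)))
    ≡⟨ cong (filterᵇ p) (reverse-allFin-suc n) ⟩
  filterᵇ p (map fsuc letters ++ [ fzero ])
    ≡⟨ filter-++ (T? ∘ p) (map fsuc letters) [ fzero ] ⟩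
  filterᵇ p (map fsuc letters) ++ filterᵇ p [ fzero ]
    ≡⟨ cong₂ _++_ (filterᵇ-map p fsuc letters) (cycleMaxima0-insert0 ρ o) ⟩
  map fsuc (filterᵇ (p ∘ fsuc) letters) ++ newCycle o
    ≡⟨ cong (λ xs → map fsuc xs ++ newCycle o) (filterᵇ-cong (isCycleMax-insert0 ρ inj o) letters) ⟩
  map fsuc (cycleMaxima ρ) ++ newCycle o
    ∎
  where
  open ≡-Reasoning
  p = isCycleMax (insert0 ρ o)
  letters = reverse (allFin n)

numCycles-insert0 : ∀ {n} (ρ : Endo n) → Injective _≡_ _≡_ (lookup ρ) → ∀ o →
  numCycles (insert0 ρ o) ≡ length (newCycle o) + numCycles ρ
numCycles-insert0 ρ inj o = begin
  length (cycleMaxima (insert0 ρ o))                       ≡⟨ cong length (cycleMaxima-insert0 ρ inj o) ⟩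
  length (map fsuc (cycleMaxima ρ) ++ newCycle o)          ≡⟨ length-++ (map fsuc (cycleMaxima ρ)) ⟩
  length (map fsuc (cycleMaxima ρ)) + length (newCycle o)  ≡⟨ cong (_+ length (newCycle o)) (length-map fsuc (cycleMaxima ρ)) ⟩
  numCycles ρ + length (newCycle o)                        ≡⟨ +-comm (numCycles ρ) _ ⟩
  length (newCycle o) + numCycles ρ                        ∎
  where open ≡-Reasoning

insert0ʷ-++ : ∀ {n} (o : Maybe (Fin n)) xs ys → insert0ʷ o (xs ++ ys) ≡ insert0ʷ o xs ++ insert0ʷ o ys
insert0ʷ-++ nothing  xs       ys = map-++ fsuc xs ys
insert0ʷ-++ (just x) []       ys = refl
insert0ʷ-++ (just x) (y ∷ xs) ys with y =ᶠ x
... | true  = cong (λ w → fsuc y ∷ fzero ∷ w) (insert0ʷ-++ (just x) xs ys)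
... | false = cong (fsuc y ∷_) (insert0ʷ-++ (just x) xs ys)

concatMap-cycleOf-insert0 : ∀ {n} (ρ : Endo n) → Injective _≡_ _≡_ (lookup ρ) → ∀ o ms →
  concatMap (cycleOf (insert0 ρ o)) (map fsuc ms) ≡ insert0ʷ o (concatMap (cycleOf ρ) ms)
concatMap-cycleOf-insert0 ρ inj nothing  [] = refl
concatMap-cycleOf-insert0 ρ inj (just _) [] = refl
concatMap-cycleOf-insert0 ρ inj o (m ∷ ms) =
  trans (cong₂ _++_ (cycleOf-insert0 ρ inj o m) (concatMap-cycleOf-insert0 ρ inj o ms))
        (sym (insert0ʷ-++ o (cycleOf ρ m) (concatMap (cycleOf ρ) ms)))

sWord-insert0 : ∀ {n} (ρ : Endo n) → Injective _≡_ _≡_ (lookup ρ) → ∀ o →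
  sWord (insert0 ρ o) ≡ insert0ʷ o (sWord ρ) ++ newCycle o
sWord-insert0 ρ inj o = begin
  concatMap (cycleOf ρ⁺) (cycleMaxima ρ⁺)
    ≡⟨ cong (concatMap (cycleOf ρ⁺)) (cycleMaxima-insert0 ρ inj o) ⟩
  concatMap (cycleOf ρ⁺) (map fsuc (cycleMaxima ρ) ++ newCycle o)
    ≡⟨ concatMap-++ (cycleOf ρ⁺) (map fsuc (cycleMaxima ρ)) (newCycle o) ⟩
  concatMap (cycleOf ρ⁺) (map fsuc (cycleMaxima ρ)) ++ concatMap (cycleOf ρ⁺) (newCycle o)
    ≡⟨ cong₂ _++_ (concatMap-cycleOf-insert0 ρ inj o (cycleMaxima ρ)) (cycleOf0-insert0 ρ o) ⟩
  insert0ʷ o (sWord ρ) ++ newCycle o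
    ∎
  where
  open ≡-Reasoning
  ρ⁺ = insert0 ρ o

countAbove : ∀ {n} → ℕ → List (Fin n) → ℕ
countAbove a w = length (filterᵇ (λ y → a <ᵇ toℕ y) w)

countAbove-append0 : ∀ {n} a (w : List (Fin n)) → countAbove (suc a) (map fsuc w ++ [ fzero ]) ≡ countAbove a w
countAbove-append0 a []      = refl
countAbove-append0 a (y ∷ w) with a <ᵇ toℕ y
... | true  = cong suc (countAbove-append0 a w)
... | false = countAbove-append0 a w

coinv-append0 : ∀ {n} (w : List (Fin n)) → coinv (map fsuc w ++ [ fzero ]) ≡ coinv w
coinv-append0 []      = refl
coinv-append0 (y ∷ w) = cong₂ _+_ (countAbove-append0 (toℕ y) w) (coinv-append0 w)

lengthAfter : ∀ {n} → Fin n → List (Fin n) → ℕ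
lengthAfter x []       = 0
lengthAfter x (y ∷ ys) = (if y =ᶠ x then length ys else 0) + lengthAfter x ys

countAbove-insert0After : ∀ {n} (x : Fin n) a w → countAbove (suc a) (insert0After x w) ≡ countAbove a w
countAbove-insert0After x a []      = refl
countAbove-insert0After x a (y ∷ w) with y =ᶠ x | a <ᵇ toℕ y
... | true  | true  = cong suc (countAbove-insert0After x a w)
... | true  | false = countAbove-insert0After x a w
... | false | true  = cong suc (countAbove-insert0After x a w)
... | false | false = countAbove-insert0After x a w

countAbove0-insert0After : ∀ {n} (x : Fin n) w → countAbove 0 (insert0After x w) ≡ length w
countAbove0-insert0After x []      = refl
countAbove0-insert0After x (y ∷ w) with y =ᶠ x
... | true  = cong suc (countAbove0-insert0After x w)
... | false = cong suc (countAbove0-insert0After x w)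

-- The new letter 0 is smaller than every letter, so it only adds one coinversion per letter after it.
coinv-insert0After : ∀ {n} (x : Fin n) w → coinv (insert0After x w) ≡ coinv w + lengthAfter x w
coinv-insert0After x []      = refl
coinv-insert0After x (y ∷ w) with y =ᶠ x
... | true  rewrite countAbove-insert0After x (toℕ y) w | countAbove0-insert0After x w | coinv-insert0After x w =
  solve 4 (λ a l c d → a :+ (l :+ (c :+ d)) := (a :+ c) :+ (l :+ d)) refl (countAbove (toℕ y) w) (length w) (coinv w) (lengthAfter x w)
... | false rewrite countAbove-insert0After x (toℕ y) w | coinv-insert0After x w =
  sym (+-assoc (countAbove (toℕ y) w) (coinv w) (lengthAfter x w))

Unique-resp-↭ : ∀ {A : Set} {xs ys : List A} → xs ↭ ys → Unique xs → Unique ys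
Unique-resp-↭ {A} p = PermutationSetoidProperties.Unique-resp-↭ (setoid A) (↭⇒↭ₛ p)

insert0After-∉ : ∀ {n} (x : Fin n) {ys} → x ∉ ys → insert0After x ys ≡ map fsuc ys
insert0After-∉ x {[]}     _   = refl
insert0After-∉ x {y ∷ ys} x∉ rewrite =ᶠ-≢ (x∉ ∘ here ∘ sym) = cong (fsuc y ∷_) (insert0After-∉ x (x∉ ∘ there))

insert0After-↭ : ∀ {n} (x : Fin n) {ys} → x ∈ ys → Unique ys → insert0After x ys ↭ fzero ∷ map fsuc ys
insert0After-↭ x {y ∷ ys} x∈ (y∉ys ∷ u) with y =ᶠ x | =ᶠ-reflects y x | x∈
... | true  | ofʸ refl | _ rewrite insert0After-∉ y (All¬⇒¬Any y∉ys) = ↭-swap (fsuc y) fzero ↭-refl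
... | false | ofⁿ y≢x | here x≡y = contradiction (sym x≡y) y≢x
... | false | ofⁿ y≢x | there x∈ys = ↭-trans (↭-prep (fsuc y) (insert0After-↭ x x∈ys u)) (↭-swap (fsuc y) fzero ↭-refl)

insert0ʷ-↭ : ∀ {n} {w : List (Fin n)} → allFin n ↭ w → ∀ o → insert0ʷ o w ++ newCycle o ↭ fzero ∷ map fsuc w
insert0ʷ-↭ {w = w} p nothing  = ++-comm (map fsuc w) [ fzero ]
insert0ʷ-↭ {n} {w} p (just x) rewrite ++-identityʳ (insert0After x w) =
  insert0After-↭ x (∈-resp-↭ p (∈-allFin x)) (Unique-resp-↭ p (allFin⁺ n))

sWord-↭ : ∀ {n} (ρ : Endo n) → Injective _≡_ _≡_ (lookup ρ) → allFin n ↭ sWord ρ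
sWord-↭ {zero}  []ᵛ inj = ↭-refl
sWord-↭ {suc n} ρ   inj
  with ρ' , o , ρ'-injective , refl ← injective⇒insert0 ρ inj
  rewrite sWord-insert0 ρ' ρ'-injective o | allFin-suc n
  = ↭-trans (↭-prep fzero (↭-map⁺ fsuc IH)) (↭-sym (insert0ʷ-↭ IH o))
  where IH = sWord-↭ ρ' ρ'-injective

∑ : ∀ {A : Set} → List A → (A → ℕ) → ℕ
∑ xs f = sum (map f xs)

syntax ∑ xs (λ x → e) = ∑[ x ← xs ] e

∑-↭ : ∀ {A : Set} {xs ys : List A} (f : A → ℕ) → xs ↭ ys → ∑ xs f ≡ ∑ ys f
∑-↭ f p = sum-↭ (↭-map⁺ f p)

∑-cong : ∀ {A : Set} (xs : List A) {f g : A → ℕ} → (∀ {x} → x ∈ xs → f x ≡ g x) → ∑ xs f ≡ ∑ xs g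
∑-cong xs f≡g = cong sum (map-cong-local (All.tabulate f≡g))

∑-zero : ∀ {A : Set} (xs : List A) → ∑[ x ← xs ] 0 ≡ 0
∑-zero []       = refl
∑-zero (x ∷ xs) = ∑-zero xs

∑-+ : ∀ {A : Set} (xs : List A) (f g : A → ℕ) → ∑[ x ← xs ] (f x + g x) ≡ ∑ xs f + ∑ xs g
∑-+ []       f g = refl
∑-+ (x ∷ xs) f g rewrite ∑-+ xs f g =
  solve 4 (λ a b c d → (a :+ b) :+ (c :+ d) := (a :+ c) :+ (b :+ d)) refl (f x) (g x) (∑ xs f) (∑ xs g)

∑-comm : ∀ {A B : Set} (xs : List A) (ys : List B) (F : A → B → ℕ) →
         ∑[ x ← xs ] ∑[ y ← ys ] F x y ≡ ∑[ y ← ys ] ∑[ x ← xs ] F x y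
∑-comm []       ys F = sym (∑-zero ys)
∑-comm (x ∷ xs) ys F = trans (cong (∑ ys (F x) +_) (∑-comm xs ys F)) (sym (∑-+ ys (F x) (λ y → ∑[ x ← xs ] F x y)))

∑-map : ∀ {A B : Set} (f : A → B) (xs : List A) (h : B → ℕ) → ∑ (map f xs) h ≡ ∑[ x ← xs ] h (f x)
∑-map f xs h = cong sum (sym (map-∘ xs))

∑-cartesianProductWith : ∀ {A B C : Set} (f : A → B → C) (xs : List A) (ys : List B) (h : C → ℕ) →
  ∑ (cartesianProductWith f xs ys) h ≡ ∑[ x ← xs ] ∑[ y ← ys ] h (f x y)
∑-cartesianProductWith f []       ys h = refl
∑-cartesianProductWith f (x ∷ xs) ys h = begin
  sum (map h (map (f x) ys ++ cartesianProductWith f xs ys))            ≡⟨ cong sum (map-++ h (map (f x) ys) _) ⟩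
  sum (map h (map (f x) ys) ++ map h (cartesianProductWith f xs ys))    ≡⟨ sum-++ (map h (map (f x) ys)) _ ⟩
  ∑ (map (f x) ys) h + ∑ (cartesianProductWith f xs ys) h              ≡⟨ cong₂ _+_ (∑-map (f x) ys h) (∑-cartesianProductWith f xs ys h) ⟩
  ∑[ y ← ys ] h (f x y) + ∑[ x ← xs ] ∑[ y ← ys ] h (f x y)            ∎
  where open ≡-Reasoning

∑-upTo-suc : ∀ n (f : ℕ → ℕ) → ∑[ d ← upTo (suc n) ] f d ≡ f 0 + ∑[ d ← upTo n ] f (suc d)
∑-upTo-suc n f = cong (f 0 +_) (cong sum (trans (map-applyUpTo suc f n) (sym (map-applyUpTo id (f ∘ suc) n))))

∑-downFrom : ∀ n (f : ℕ → ℕ) → ∑ (downFrom n) f ≡ ∑ (upTo n) f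
∑-downFrom n f = begin
  sum (map f (downFrom n))            ≡⟨ cong (sum ∘ map f) (sym (reverse-upTo n)) ⟩
  sum (map f (reverse (upTo n)))      ≡⟨ cong sum (reverse-map f (upTo n)) ⟩
  sum (reverse (map f (upTo n)))      ≡⟨ sum-↭ (↭-reverse (map f (upTo n))) ⟩
  sum (map f (upTo n))                ∎
  where open ≡-Reasoning

lengthAfter-∉ : ∀ {n} (x : Fin n) {ys} → All (x ≢_) ys → lengthAfter x ys ≡ 0
lengthAfter-∉ x []                 = refl
lengthAfter-∉ x (x≢y ∷ x∉ys) rewrite =ᶠ-≢ (x≢y ∘ sym) = lengthAfter-∉ x x∉ys

lengthAfter-∷-≢ : ∀ {n} {x y : Fin n} {ys} → y ≢ x → lengthAfter x (y ∷ ys) ≡ lengthAfter x ys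
lengthAfter-∷-≢ y≢x rewrite =ᶠ-≢ y≢x = refl

lengthAfter-map : ∀ {n} (w : List (Fin n)) → Unique w → map (λ x → lengthAfter x w) w ≡ downFrom (length w)
lengthAfter-map []      _ = refl
lengthAfter-map (y ∷ w) (y∉w ∷ u) rewrite =ᶠ-refl y | lengthAfter-∉ y y∉w | +-identityʳ (length w) =
  cong (length w ∷_) (trans (map-cong-local (All.map (lengthAfter-∷-≢ {ys = w}) y∉w)) (lengthAfter-map w u))

-- In a word listing every letter once, the letters have 0, 1, …, n − 1 letters after them.
∑-lengthAfter : ∀ {n} {w : List (Fin n)} → allFin n ↭ w → ∀ h →
                ∑[ x ← allFin n ] h (lengthAfter x w) ≡ ∑[ d ← upTo n ] h d
∑-lengthAfter {n} {w} p h = begin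
  ∑[ x ← allFin n ] h (lengthAfter x w)  ≡⟨ ∑-↭ (h ∘ (λ x → lengthAfter x w)) p ⟩
  ∑[ x ← w ] h (lengthAfter x w)         ≡⟨ sym (∑-map (λ x → lengthAfter x w) w h) ⟩
  ∑ (map (λ x → lengthAfter x w) w) h    ≡⟨ cong (λ ds → ∑ ds h) (lengthAfter-map w (Unique-resp-↭ p (allFin⁺ n))) ⟩
  ∑ (downFrom (length w)) h              ≡⟨ cong (λ m → ∑ (downFrom m) h) length-w ⟩
  ∑ (downFrom n) h                       ≡⟨ ∑-downFrom n h ⟩
  ∑[ d ← upTo n ] h d                    ∎
  where
  open ≡-Reasoning
  length-w : length w ≡ n
  length-w = trans (sym (↭-length p)) (length-tabulate id)

-- Enumerating permutations

concatMap-map≡cartesianProductWith : ∀ {A B C : Set} (f : A → B → C) xs ys →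
  concatMap (λ x → map (f x) ys) xs ≡ cartesianProductWith f xs ys
concatMap-map≡cartesianProductWith f []       ys = refl
concatMap-map≡cartesianProductWith f (x ∷ xs) ys = cong (map (f x) ys ++_) (concatMap-map≡cartesianProductWith f xs ys)

allVecs-unique : ∀ n m → Unique (allVecs n m)
allVecs-unique n zero    = [] ∷ []
allVecs-unique n (suc m) rewrite concatMap-map≡cartesianProductWith _∷ᵛ_ (allFin n) (allVecs n m) =
  cartesianProductWith⁺ _∷ᵛ_ ∷-injective (allFin⁺ n) (allVecs-unique n m)

∈-allVecs : ∀ n m (v : Vec (Fin n) m) → v ∈ allVecs n m
∈-allVecs n zero    []ᵛ       = here refl
∈-allVecs n (suc m) (x ∷ᵛ v) rewrite concatMap-map≡cartesianProductWith _∷ᵛ_ (allFin n) (allVecs n m) =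
  ∈-cartesianProductWith⁺ _∷ᵛ_ (∈-allFin x) (∈-allVecs n m v)

perms : ∀ n → List (Endo n)
perms n = filterᵇ isPerm (allVecs n n)

perms-unique : ∀ n → Unique (perms n)
perms-unique n = filter⁺ (T? ∘ isPerm) (allVecs-unique n n)

∈-perms⁻ : ∀ {n} {ρ : Endo n} → ρ ∈ perms n → Injective _≡_ _≡_ (lookup ρ)
∈-perms⁻ {n} {ρ} ρ∈ = Equivalence.to (isPerm⇔injective ρ) (proj₂ (∈-filter⁻ (T? ∘ isPerm) {xs = allVecs n n} ρ∈))

∈-perms⁺ : ∀ {n} {ρ : Endo n} → Injective _≡_ _≡_ (lookup ρ) → ρ ∈ perms n
∈-perms⁺ {n} {ρ} inj = ∈-filter⁺ (T? ∘ isPerm) (∈-allVecs n n ρ) (Equivalence.from (isPerm⇔injective ρ) inj)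

options : ∀ n → List (Maybe (Fin n))
options n = nothing ∷ map just (allFin n)

options-unique : ∀ n → Unique (options n)
options-unique n = All.tabulate nothing∉ ∷ map⁺ just-injective (allFin⁺ n)
  where
  nothing∉ : ∀ {o} → o ∈ map just (allFin n) → nothing ≢ o
  nothing∉ o∈ refl with _ , _ , () ← ∈-map⁻ just o∈

∈-options : ∀ {n} (o : Maybe (Fin n)) → o ∈ options n
∈-options nothing  = here refl
∈-options (just x) = there (∈-map⁺ just (∈-allFin x))

perms-suc-↭ : ∀ n → perms (suc n) ↭ cartesianProductWith insert0 (perms n) (options n)
perms-suc-↭ n = ∼bag⇒↭ (unique∧set⇒bag (perms-unique (suc n))
  (cartesianProductWith⁺ insert0 insert0-injective (perms-unique n) (options-unique n)) (mk⇔ to from))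
  where
  to : ∀ {ρ} → ρ ∈ perms (suc n) → ρ ∈ cartesianProductWith insert0 (perms n) (options n)
  to {ρ} ρ∈ = let ρ' , o , ρ'-injective , ρ≡ = injective⇒insert0 ρ (∈-perms⁻ ρ∈) in
    subst (_∈ _) (sym ρ≡) (∈-cartesianProductWith⁺ insert0 (∈-perms⁺ {ρ = ρ'} ρ'-injective) (∈-options o))
  from : ∀ {ρ} → ρ ∈ cartesianProductWith insert0 (perms n) (options n) → ρ ∈ perms (suc n)
  from ρ∈ with ρ' , o , ρ'∈ , _ , refl ← ∈-cartesianProductWith⁻ insert0 (perms n) (options n) ρ∈
    = ∈-perms⁺ (insert0-preserves-injective ρ' (∈-perms⁻ ρ'∈) o)

χ : Bool → ℕ
χ true  = 1
χ false = 0

-- delay d f is the coefficient sequence of q^d · f.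
delay : ℕ → (ℕ → ℕ) → ℕ → ℕ
delay zero    f k       = f k
delay (suc d) f zero    = 0
delay (suc d) f (suc k) = delay d f k

delay-cong : ∀ {f g : ℕ → ℕ} → f ≗ g → ∀ d k → delay d f k ≡ delay d g k
delay-cong f≗g zero    k       = f≗g k
delay-cong f≗g (suc d) zero    = refl
delay-cong f≗g (suc d) (suc k) = delay-cong f≗g d k

delay-zero : ∀ d k → delay d (λ _ → 0) k ≡ 0
delay-zero zero    k       = refl
delay-zero (suc d) zero    = refl
delay-zero (suc d) (suc k) = delay-zero d k

∑-delay : ∀ {A : Set} (xs : List A) (F : A → ℕ → ℕ) d k →
          ∑[ x ← xs ] delay d (F x) k ≡ delay d (λ k → ∑[ x ← xs ] F x k) k
∑-delay xs F zero    k       = refl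
∑-delay xs F (suc d) zero    = ∑-zero xs
∑-delay xs F (suc d) (suc k) = ∑-delay xs F d k

χ-∧-+-delay : ∀ b c d k → χ (b ∧ (c + d ≡ᵇ k)) ≡ delay d (λ k → χ (b ∧ (c ≡ᵇ k))) k
χ-∧-+-delay b c zero    k       rewrite +-identityʳ c = refl
χ-∧-+-delay b c (suc d) zero    rewrite +-suc c d | ∧-zeroʳ b = refl
χ-∧-+-delay b c (suc d) (suc k) rewrite +-suc c d = χ-∧-+-delay b c d k

weight : ℕ → ℕ → ∀ {n} → Endo n → ℕ
weight j k ρ = χ ((numCycles ρ ≡ᵇ j) ∧ (coinv (sWord ρ) ≡ᵇ k))

permCount : ℕ → ℕ → ℕ → ℕ
permCount n j k = ∑[ ρ ← perms n ] weight j k ρ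

length-filterᵇ-∧ : ∀ {A : Set} (a b : A → Bool) xs → length (filterᵇ (λ x → a x ∧ b x) xs) ≡ ∑[ x ← filterᵇ a xs ] χ (b x)
length-filterᵇ-∧ a b []       = refl
length-filterᵇ-∧ a b (x ∷ xs) with a x
... | false = length-filterᵇ-∧ a b xs
... | true with b x
...   | true  = cong suc (length-filterᵇ-∧ a b xs)
...   | false = length-filterᵇ-∧ a b xs

countPerms≡permCount : ∀ n j k → countPerms n j k ≡ permCount n j k
countPerms≡permCount n j k = length-filterᵇ-∧ isPerm (λ ρ → (numCycles ρ ≡ᵇ j) ∧ (coinv (sWord ρ) ≡ᵇ k)) (allVecs n n)

weight-insert0-nothing : ∀ {n} (ρ : Endo n) → Injective _≡_ _≡_ (lookup ρ) → ∀ j k →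
  weight j k (insert0 ρ nothing) ≡ delay 1 (λ j → weight j k ρ) j
weight-insert0-nothing ρ inj j k
  rewrite numCycles-insert0 ρ inj nothing | sWord-insert0 ρ inj nothing | coinv-append0 (sWord ρ) with j
... | zero  = refl
... | suc j = refl

weight-insert0-just : ∀ {n} (ρ : Endo n) → Injective _≡_ _≡_ (lookup ρ) → ∀ x j k →
  weight j k (insert0 ρ (just x)) ≡ delay (lengthAfter x (sWord ρ)) (λ k → weight j k ρ) k
weight-insert0-just ρ inj x j k = trans
  (cong₂ (λ m c → χ ((m ≡ᵇ j) ∧ (c ≡ᵇ k))) (numCycles-insert0 ρ inj (just x)) coinv≡)
  (χ-∧-+-delay (numCycles ρ ≡ᵇ j) (coinv (sWord ρ)) (lengthAfter x (sWord ρ)) k)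
  where
  coinv≡ : coinv (sWord (insert0 ρ (just x))) ≡ coinv (sWord ρ) + lengthAfter x (sWord ρ)
  coinv≡ = trans (cong coinv (trans (sWord-insert0 ρ inj (just x)) (++-identityʳ _))) (coinv-insert0After x (sWord ρ))

∑-weight-insert0 : ∀ {n} (ρ : Endo n) → Injective _≡_ _≡_ (lookup ρ) → ∀ j k →
  ∑[ o ← options n ] weight j k (insert0 ρ o) ≡
    delay 1 (λ j → weight j k ρ) j + ∑[ d ← upTo n ] delay d (λ k → weight j k ρ) k
∑-weight-insert0 {n} ρ inj j k = cong₂ _+_ (weight-insert0-nothing ρ inj j k) (begin
  ∑ (map just (allFin n)) (weight j k ∘ insert0 ρ)
    ≡⟨ ∑-map just (allFin n) (weight j k ∘ insert0 ρ) ⟩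
  ∑[ x ← allFin n ] weight j k (insert0 ρ (just x))
    ≡⟨ ∑-cong (allFin n) (λ {x} _ → weight-insert0-just ρ inj x j k) ⟩
  ∑[ x ← allFin n ] delay (lengthAfter x (sWord ρ)) (λ k → weight j k ρ) k
    ≡⟨ ∑-lengthAfter (sWord-↭ ρ inj) (λ d → delay d (λ k → weight j k ρ) k) ⟩
  ∑[ d ← upTo n ] delay d (λ k → weight j k ρ) k
    ∎)
  where open ≡-Reasoning

-- c(n+1, j) = c(n, j−1) + [n] c(n, j), read coefficientwise, with c(n, −1) = 0.
StirlingRecurrence : (ℕ → ℕ → ℕ → ℕ) → Set
StirlingRecurrence a = ∀ n j k → a (suc n) j k ≡ delay 1 (λ j → a n j k) j + ∑[ d ← upTo n ] delay d (a n j) k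

StirlingRecurrence-unique : ∀ {a b} → StirlingRecurrence a → StirlingRecurrence b →
  (∀ j k → a 0 j k ≡ b 0 j k) → ∀ n j k → a n j k ≡ b n j k
StirlingRecurrence-unique rec-a rec-b a₀≡b₀ zero    = a₀≡b₀
StirlingRecurrence-unique {a} {b} rec-a rec-b a₀≡b₀ (suc n) j k = begin
  a (suc n) j k
    ≡⟨ rec-a n j k ⟩
  delay 1 (λ j → a n j k) j + ∑[ d ← upTo n ] delay d (a n j) k
    ≡⟨ cong₂ _+_ (delay-cong (λ j → aₙ≡bₙ j k) 1 j) (∑-cong (upTo n) λ {d} _ → delay-cong (aₙ≡bₙ j) d k) ⟩
  delay 1 (λ j → b n j k) j + ∑[ d ← upTo n ] delay d (b n j) k
    ≡⟨ sym (rec-b n j k) ⟩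
  b (suc n) j k
    ∎
  where
  open ≡-Reasoning
  aₙ≡bₙ = StirlingRecurrence-unique rec-a rec-b a₀≡b₀ n

permCount-recurrence : StirlingRecurrence permCount
permCount-recurrence n j k = begin
  ∑[ ρ ← perms (suc n) ] weight j k ρ
    ≡⟨ ∑-↭ (weight j k) (perms-suc-↭ n) ⟩
  ∑ (cartesianProductWith insert0 (perms n) (options n)) (weight j k)
    ≡⟨ ∑-cartesianProductWith insert0 (perms n) (options n) (weight j k) ⟩
  ∑[ ρ ← perms n ] ∑[ o ← options n ] weight j k (insert0 ρ o)
    ≡⟨ ∑-cong (perms n) (λ {ρ} ρ∈ → ∑-weight-insert0 ρ (∈-perms⁻ ρ∈) j k) ⟩
  ∑[ ρ ← perms n ] (delay 1 (λ j → weight j k ρ) j + ∑[ d ← upTo n ] delay d (λ k → weight j k ρ) k)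
    ≡⟨ ∑-+ (perms n) _ _ ⟩
  ∑[ ρ ← perms n ] delay 1 (λ j → weight j k ρ) j + ∑[ ρ ← perms n ] ∑[ d ← upTo n ] delay d (λ k → weight j k ρ) k
    ≡⟨ cong₂ _+_ (∑-delay (perms n) (λ ρ j → weight j k ρ) 1 j) (∑-comm (perms n) (upTo n) _) ⟩
  delay 1 (λ j → permCount n j k) j + ∑[ d ← upTo n ] ∑[ ρ ← perms n ] delay d (λ k → weight j k ρ) k
    ≡⟨ cong (delay 1 (λ j → permCount n j k) j +_) (∑-cong (upTo n) λ {d} _ → ∑-delay (perms n) (λ ρ k → weight j k ρ) d k) ⟩
  delay 1 (λ j → permCount n j k) j + ∑[ d ← upTo n ] delay d (permCount n j) k
    ∎
  where open ≡-Reasoning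

coeff-⊕ : ∀ p q k → coeff (p ⊕ q) k ≡ coeff p k + coeff q k
coeff-⊕ []      q       k       = refl
coeff-⊕ (a ∷ p) []      k       = sym (+-identityʳ _)
coeff-⊕ (a ∷ p) (b ∷ q) zero    = refl
coeff-⊕ (a ∷ p) (b ∷ q) (suc k) = coeff-⊕ p q k

coeff-scale1 : ∀ p k → coeff (scale 1 p) k ≡ coeff p k
coeff-scale1 []      k       = refl
coeff-scale1 (a ∷ p) zero    = +-identityʳ a
coeff-scale1 (a ∷ p) (suc k) = coeff-scale1 p k

coeff-qint-⊗ : ∀ n p k → coeff (qint n ⊗ p) k ≡ ∑[ d ← upTo n ] delay d (coeff p) k
coeff-qint-⊗ zero    p k = refl
coeff-qint-⊗ (suc n) p k = begin
  coeff (scale 1 p ⊕ (0 ∷ qint n ⊗ p)) k                            ≡⟨ coeff-⊕ (scale 1 p) (0 ∷ qint n ⊗ p) k ⟩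
  coeff (scale 1 p) k + coeff (0 ∷ qint n ⊗ p) k                    ≡⟨ cong₂ _+_ (coeff-scale1 p k) (shifted k) ⟩
  coeff p k + ∑[ d ← upTo n ] delay (suc d) (coeff p) k            ≡⟨ sym (∑-upTo-suc n (λ d → delay d (coeff p) k)) ⟩
  ∑[ d ← upTo (suc n) ] delay d (coeff p) k                         ∎
  where
  open ≡-Reasoning
  shifted : ∀ k → coeff (0 ∷ qint n ⊗ p) k ≡ ∑[ d ← upTo n ] delay (suc d) (coeff p) k
  shifted zero    = sym (∑-zero (upTo n))
  shifted (suc k) = coeff-qint-⊗ n p k

coeff-c-recurrence : StirlingRecurrence (λ n j k → coeff (c n j) k)
coeff-c-recurrence n       (suc j) k = trans (coeff-⊕ (c n j) _ k) (cong (coeff (c n j) k +_) (coeff-qint-⊗ n (c n (suc j)) k))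
coeff-c-recurrence zero    zero    k = refl
coeff-c-recurrence (suc n) zero    k =
  sym (trans (∑-cong (upTo (suc n)) λ {d} _ → delay-zero d k) (∑-zero (upTo (suc n))))

corollaryC : (j n k : ℕ) → coeff (c n j) k ≡ countPerms n j k
corollaryC j n k =
  trans (StirlingRecurrence-unique coeff-c-recurrence permCount-recurrence initial n j k)
        (sym (countPerms≡permCount n j k))
  where
  initial : ∀ j k → coeff (c 0 j) k ≡ permCount 0 j k
  initial zero    zero    = refl
  initial zero    (suc k) = refl
  initial (suc j) k       = refl
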